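{- Let $\gamma$ be an infinite limit ordinal. The graph $\mathcal G_\gamma$ is cop-win.
   Context: $\mathcal G_\gamma$ is the graph with vertex set $\gamma\times\gamma$ in which $\{(\alpha_0,\beta_0),(\alpha_1,\beta_1)\}$ (two distinct vertices) is an edge iff $\alpha_0=\alpha_1=0$, or $\beta_0=\beta_1=0$, or ($\alpha_0=\beta_0$ and $\alpha_1=\beta_1$), or ($\alpha_0<\alpha_1$ and $\beta_0>\beta_1$), or ($\alpha_0>\alpha_1$ and $\beta_0<\beta_1$). The game of cops and robbers: the cop picks a starting vertex, then the robber; they alternate moves, cop first, each move going to an adjacent vertex or staying put; the cop wins if he lands on the robber. A graph is cop-win if the cop has a winning strategy. -}

module Defs where

open import Level using (0ℓ)
open import Data.Product using (Σ; ∃; _×_; _,_)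
open import Data.Sum using (_⊎_)
open import Relation.Nullary using (¬_)
open import Relation.Binary.Core using (Rel)
open import Relation.Binary.Structures using (IsStrictTotalOrder)
open import Relation.Binary.PropositionalEquality using (_≡_)
open import Induction.WellFounded using (WellFounded)

-- An ordinal γ, presented as its set of elements {α : α < γ} with the
-- strict well-order <.  "Infinite limit ordinal" = nonzero ordinal with
-- no largest element (equivalently: γ ≠ 0 and γ is not a successor).
record InfiniteLimitOrdinal : Set₁ where
  field
    Carrier            : Set
    _<_                : Rel Carrier 0ℓ
    isStrictTotalOrder : IsStrictTotalOrder _≡_ _<_
    wellFounded        : WellFounded _<_
    𝟘                  : Carrier
    𝟘-least            : ∀ x → ¬ (x < 𝟘)
    noMax              : ∀ x → ∃ λ y → x < y

record Graph : Set₁ where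
  field
    V   : Set
    Adj : V → V → Set

module _ (G : Graph) where
  open Graph G

  Step : V → V → Set
  Step x y = x ≡ y ⊎ Adj x y

  -- CopWins c r : cop at c, robber at r, cop to move; the cop can force
  -- capture in finitely many moves (well-founded game tree).
  data CopWins (c r : V) : Set where
    move : (c' : V) → Step c c' →
           (c' ≡ r ⊎ ((r' : V) → Step r r' → CopWins c' r')) →
           CopWins c r

  CopWin : Set
  CopWin = Σ V λ c → (r : V) → CopWins c r

module _ (γ : InfiniteLimitOrdinal) where
  open InfiniteLimitOrdinal γ

  𝒢-Adj : Carrier × Carrier → Carrier × Carrier → Set
  𝒢-Adj (α₀ , β₀) (α₁ , β₁) =
    ¬ ((α₀ , β₀) ≡ (α₁ , β₁)) ×
    ( (α₀ ≡ 𝟘 × α₁ ≡ 𝟘)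
    ⊎ (β₀ ≡ 𝟘 × β₁ ≡ 𝟘)
    ⊎ (α₀ ≡ β₀ × α₁ ≡ β₁)
    ⊎ (α₀ < α₁ × β₁ < β₀)
    ⊎ (α₁ < α₀ × β₀ < β₁))

  𝒢 : Graph
  𝒢 = record { V = Carrier × Carrier ; Adj = 𝒢-Adj }

{-# OPTIONS --safe #-}
module Submission where

-- The cop starts at (0,0).  A robber on the diagonal is caught at once; otherwise, by the
-- symmetry (α,β) ↦ (β,α) of 𝒢_γ, he is at some (α,β) with α < β.  The cop moves along the
-- row {0} × γ to (0,β') with β < β', possible because γ is a limit.  From (0,β') he sees
-- every vertex with second coordinate below β', so the robber must move to some (α',β'')
-- with α' < α < β < β''.  The invariant α < β is restored with a smaller first coordinate,
-- so well-foundedness ends the chase.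

open import Defs
open import Data.Product using (_×_; _,_; swap)
open import Data.Product.Properties using (≡-dec)
open import Data.Sum using (inj₁; inj₂)
open import Data.Empty using (⊥-elim)
open import Relation.Nullary using (¬_; yes; no)
open import Relation.Binary.PropositionalEquality using (_≡_; refl; sym; cong; subst)
open import Relation.Binary.Structures using (IsStrictTotalOrder)
open import Relation.Binary.Definitions using (tri<; tri≈; tri>)
open import Induction.WellFounded using (Acc; acc)

module _ {G : Graph} where
  open Graph G

  Step-map : (f : V → V) → (∀ {x y} → Adj x y → Adj (f x) (f y)) →
             ∀ {x y} → Step G x y → Step G (f x) (f y)
  Step-map f f-adj (inj₁ x≡y) = inj₁ (cong f x≡y)
  Step-map f f-adj (inj₂ xy)  = inj₂ (f-adj xy)

  CopWins-involution : (f : V → V) → (∀ x → f (f x) ≡ x) →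
                       (∀ {x y} → Adj x y → Adj (f x) (f y)) →
                       ∀ {c r} → CopWins G c r → CopWins G (f c) (f r)
  CopWins-involution f f-involutive f-adj (move c' cc' (inj₁ c'≡r)) =
    move (f c') (Step-map f f-adj cc') (inj₁ (cong f c'≡r))
  CopWins-involution f f-involutive f-adj {r = r} (move c' cc' (inj₂ win)) =
    move (f c') (Step-map f f-adj cc') (inj₂ λ r' fr-r' →
      subst (CopWins G (f c')) (f-involutive r')
        (CopWins-involution f f-involutive f-adj
          (win (f r') (subst (λ s → Step G s (f r')) (f-involutive r)
                             (Step-map f f-adj fr-r')))))

pattern row       p q = inj₁ (p , q)
pattern column    p q = inj₂ (inj₁ (p , q))
pattern diagonal  p q = inj₂ (inj₂ (inj₁ (p , q)))
pattern rightDown p q = inj₂ (inj₂ (inj₂ (inj₁ (p , q))))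
pattern leftUp    p q = inj₂ (inj₂ (inj₂ (inj₂ (p , q))))

module _ (γ : InfiniteLimitOrdinal) where
  open InfiniteLimitOrdinal γ
  open IsStrictTotalOrder isStrictTotalOrder

  Vertex : Set
  Vertex = Carrier × Carrier

  swap-Adj : ∀ {x y : Vertex} → 𝒢-Adj γ x y → 𝒢-Adj γ (swap x) (swap y)
  swap-Adj (x≢y , row p q)       = (λ e → x≢y (cong swap e)) , column p q
  swap-Adj (x≢y , column p q)    = (λ e → x≢y (cong swap e)) , row p q
  swap-Adj (x≢y , diagonal p q)  = (λ e → x≢y (cong swap e)) , diagonal (sym p) (sym q)
  swap-Adj (x≢y , rightDown p q) = (λ e → x≢y (cong swap e)) , leftUp q p
  swap-Adj (x≢y , leftUp p q)    = (λ e → x≢y (cong swap e)) , rightDown q p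

  Step-if-Adj-when-distinct : ∀ {x y : Vertex} → (¬ x ≡ y → 𝒢-Adj γ x y) → Step (𝒢 γ) x y
  Step-if-Adj-when-distinct {x} {y} adj with ≡-dec _≟_ _≟_ x y
  ... | yes x≡y = inj₁ x≡y
  ... | no  x≢y = inj₂ (adj x≢y)

  𝟘<-if-≢𝟘 : ∀ {α} → ¬ α ≡ 𝟘 → 𝟘 < α
  𝟘<-if-≢𝟘 {α} α≢𝟘 with compare α 𝟘
  ... | tri< α<𝟘 _ _ = ⊥-elim (𝟘-least α α<𝟘)
  ... | tri≈ _ α≡𝟘 _ = ⊥-elim (α≢𝟘 α≡𝟘)
  ... | tri> _ _ 𝟘<α = 𝟘<α

  Step-row : ∀ β β' → Step (𝒢 γ) (𝟘 , β) (𝟘 , β')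
  Step-row β β' = Step-if-Adj-when-distinct λ ne → ne , row refl refl

  Step-diagonal : ∀ α α' → Step (𝒢 γ) (α , α) (α' , α')
  Step-diagonal α α' = Step-if-Adj-when-distinct λ ne → ne , diagonal refl refl

  Step-row-below : ∀ α {β β'} → β < β' → Step (𝒢 γ) (𝟘 , β') (α , β)
  Step-row-below α {β} {β'} β<β' with α ≟ 𝟘
  ... | yes refl = Step-row β' β
  ... | no  α≢𝟘  = Step-if-Adj-when-distinct λ ne → ne , rightDown (𝟘<-if-≢𝟘 α≢𝟘) β<β'

  capture : ∀ {c r} → Step (𝒢 γ) c r → CopWins (𝒢 γ) c r
  capture {r = r} c-r = move r c-r (inj₁ refl)

  CopWins-row-below-diagonal : ∀ α → Acc _<_ α → ∀ δ β → α < β →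
                               CopWins (𝒢 γ) (𝟘 , δ) (α , β)
  CopWins-row-below-diagonal α (acc smaller) δ β α<β with noMax β
  ... | β' , β<β' = move (𝟘 , β') (Step-row δ β') (inj₂ robber-moves)
    where
    robber-moves : ∀ r → Step (𝒢 γ) (α , β) r → CopWins (𝒢 γ) (𝟘 , β') r
    robber-moves _ (inj₁ refl) = capture (Step-row-below α β<β')
    robber-moves (_ , β'') (inj₂ (_ , row _ refl)) = capture (Step-row β' β'')
    robber-moves _ (inj₂ (_ , column refl _)) = ⊥-elim (𝟘-least α α<β)
    robber-moves _ (inj₂ (_ , diagonal α≡β _)) = ⊥-elim (irrefl α≡β α<β)
    robber-moves (α' , _) (inj₂ (_ , rightDown _ β''<β)) =
      capture (Step-row-below α' (trans β''<β β<β'))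
    robber-moves (α' , β'') (inj₂ (_ , leftUp α'<α β<β'')) =
      CopWins-row-below-diagonal α' (smaller α'<α) β' β'' (trans α'<α (trans α<β β<β''))

  CopWins-origin : ∀ r → CopWins (𝒢 γ) (𝟘 , 𝟘) r
  CopWins-origin (α , β) with compare α β
  ... | tri< α<β _ _ = CopWins-row-below-diagonal α (wellFounded α) 𝟘 β α<β
  ... | tri≈ _ refl _ = capture (Step-diagonal 𝟘 α)
  ... | tri> _ _ β<α =
    CopWins-involution swap (λ _ → refl) swap-Adj
      (CopWins-row-below-diagonal β (wellFounded β) 𝟘 α β<α)

proposition1 : (γ : InfiniteLimitOrdinal) → CopWin (𝒢 γ)
proposition1 γ = (𝟘 , 𝟘) , CopWins-origin γ
  where open InfiniteLimitOrdinal γ
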